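{- There is an absolute constant $c>0$ such that the following holds. Let $n$ be a positive integer, $p\ge 100/n$, and let $G$ be an $n$-vertex tripartite graph with tripartition $V(G)=A\cup B\cup C$ that contains at least $pn^2$ edge-disjoint triangles. Then $G$ contains at least $c\,p^3n^4$ paths $x_1x_2x_3x_4$ (on four distinct vertices) with $x_1,x_4\in A$, $x_2\in B$ and $x_3\in C$.
   Formalization: The parameter p ranges only over the rationals, and the absolute constant c is likewise taken in the rationals. -}

module Defs where

open import Data.Nat using (ℕ; suc)
open import Data.Bool using (Bool; true; false; T; _∧_; not)
open import Data.Fin using (Fin; zero; suc)
open import Data.Fin.Properties using (_≟_)
open import Data.List using (List; length; filter; allFin; concatMap; map; [_])
open import Data.Product using (_×_; _,_; ∃-syntax; Σ-syntax)
open import Relation.Nullary using (¬_; does)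
open import Relation.Binary.PropositionalEquality using (_≡_; _≢_)
open import Relation.Unary using (Decidable)

record Graph (n : ℕ) : Set where
  field
    adj   : Fin n → Fin n → Bool
    sym   : ∀ u v → adj u v ≡ adj v u
    irrefl : ∀ u → adj u u ≡ false

open Graph public

Adj : ∀ {n} → Graph n → Fin n → Fin n → Set
Adj G u v = T (adj G u v)

partA partB partC : Fin 3
partA = zero
partB = suc zero
partC = suc (suc zero)

IsTripartition : ∀ {n} → Graph n → (Fin n → Fin 3) → Set
IsTripartition G part = ∀ u v → Adj G u v → part u ≢ part v

-- A triangle of G: three vertices, pairwise adjacent (hence distinct).
IsTriangle : ∀ {n} (G : Graph n) → Fin n × Fin n × Fin n → Set
IsTriangle G (x , y , z) = Adj G x y × Adj G y z × Adj G x z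

_∈T_ : ∀ {n} → Fin n → Fin n × Fin n × Fin n → Set
v ∈T (x , y , z) = (v ≡ x) ⊎' ((v ≡ y) ⊎' (v ≡ z))
  where
  open import Data.Sum renaming (_⊎_ to _⊎'_)

ShareEdge : ∀ {n} → Fin n × Fin n × Fin n → Fin n × Fin n × Fin n → Set
ShareEdge {n} S T = ∃[ u ] ∃[ v ] (u ≢ v × u ∈T S × v ∈T S × u ∈T T × v ∈T T)

HasEdgeDisjointTriangles : ∀ {n} → Graph n → ℕ → Set
HasEdgeDisjointTriangles {n} G m =
  Σ[ t ∈ (Fin m → Fin n × Fin n × Fin n) ] (((i : Fin m) → IsTriangle G (t i))
         × (∀ (i j : Fin m) → i ≢ j → ¬ ShareEdge (t i) (t j)))

quadruples : (n : ℕ) → List (Fin n × Fin n × Fin n × Fin n)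
quadruples n =
  concatMap (λ a → concatMap (λ b → concatMap (λ c → map (λ d → (a , b , c , d))
    (allFin n)) (allFin n)) (allFin n)) (allFin n)

_==_ : ∀ {n} → Fin n → Fin n → Bool
u == v = does (u ≟ v)

isABCAPath : ∀ {n} → Graph n → (Fin n → Fin 3) → Fin n × Fin n × Fin n × Fin n → Bool
isABCAPath G part (x1 , x2 , x3 , x4) =
  (part x1 == partA) ∧ (part x2 == partB) ∧ (part x3 == partC) ∧ (part x4 == partA)
  ∧ adj G x1 x2 ∧ adj G x2 x3 ∧ adj G x3 x4
  ∧ not (x1 == x2) ∧ not (x1 == x3) ∧ not (x1 == x4)
  ∧ not (x2 == x3) ∧ not (x2 == x4) ∧ not (x3 == x4)

numABCAPaths : ∀ {n} → Graph n → (Fin n → Fin 3) → ℕ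
numABCAPaths {n} G part = length (filter (λ q → T? (isABCAPath G part q)) (quadruples n))
  where
  open import Relation.Nullary.Decidable using () renaming (T? to T?)

{-# OPTIONS --safe #-}
module Submission where

-- Let t₁, …, t_m (m ≥ pn²) be the edge-disjoint triangles, with vertices aᵢ ∈ A,
-- bᵢ ∈ B, cᵢ ∈ C; edge-disjointness means that any two of aᵢ, bᵢ, cᵢ determine i.
-- For fixed i, every j with b_j = bᵢ and every k with c_k = cᵢ and a_k ≠ a_j give the
-- path a_j bᵢ cᵢ a_k, and distinct triples (i, j, k) give distinct paths.  As at most
-- one such k has a_k = a_j, triangle i contributes at least d(bᵢ)(d(cᵢ) − 1) paths,
-- where d(v), the size of the fibre over v of i ↦ bᵢ (or i ↦ cᵢ), is the number of
-- triangles through v.  Call v light if 4n·d(v) < m: light vertices lie in fewer than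
-- n · m/(4n) = m/4 triangles, so at least m/2 triangles have bᵢ and cᵢ both heavy, and
-- each of those contributes at least (m/4n)(m/8n) paths (here m ≥ 100n ensures
-- d(cᵢ) ≥ 2).  Hence there are at least m³/(64n²) ≥ p³n⁴/64 paths.

open import Defs hiding (sym)

module Counting where

  open import Data.Bool using (Bool; true; false; T; _∧_; not)
  open import Data.Bool.Properties using (T-∧)
  open import Data.Fin using (Fin; zero; suc)
  open import Data.Fin.Properties using (_≟_; suc-injective)
  open import Data.List using (List; length; filter; tabulate; concat; concatMap; map; allFin; _++_)
  open import Data.List.Properties using (filter-++; length-++; map-tabulate)
  open import Data.Nat using (ℕ; zero; suc; _+_; _*_; _≤_; z≤n; s≤s; _<ᵇ_)
  open import Data.Nat.Properties
    using (≤-trans; ≤-reflexive; <⇒≤; <ᵇ⇒<; +-identityʳ; +-mono-≤; *-assoc; *-identityˡ;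
           *-identityʳ; *-zeroʳ; *-monoˡ-≤; *-monoʳ-≤; module ≤-Reasoning; +-*-semiring)
  open import Algebra.Properties.Semiring.Sum +-*-semiring
    using (sum-syntax; ∑-comm; *-distribˡ-sum; *-distribʳ-sum; sum-cong-≗; sum-replicate-zero)
  open import Data.Product using (_×_; _,_)
  open import Function using (_∘_; id; Equivalence)
  open import Relation.Binary.PropositionalEquality
  open import Relation.Nullary.Decidable using (T?; yes; no)

  𝟙 : Bool → ℕ
  𝟙 true  = 1
  𝟙 false = 0

  𝟙-∧ : ∀ x y → 𝟙 (x ∧ y) ≡ 𝟙 x * 𝟙 y
  𝟙-∧ true  y = sym (+-identityʳ (𝟙 y))
  𝟙-∧ false y = refl

  𝟙-*-≤ : ∀ b {x y} → (T b → x ≤ y) → 𝟙 b * x ≤ y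
  𝟙-*-≤ true  {x} x≤y = ≤-trans (≤-reflexive (+-identityʳ x)) (x≤y _)
  𝟙-*-≤ false     x≤y = z≤n

  𝟙-*-mono-≤ : ∀ b {x y} → (T b → x ≤ y) → 𝟙 b * x ≤ 𝟙 b * y
  𝟙-*-mono-≤ true  x≤y = *-monoʳ-≤ 1 (x≤y _)
  𝟙-*-mono-≤ false x≤y = z≤n

  𝟙-split : ∀ x y z → (T x → T (not y) → T z) → 𝟙 x ≤ 𝟙 (x ∧ y) + 𝟙 x * 𝟙 z
  𝟙-split false y     z     _ = z≤n
  𝟙-split true  true  z     _ = s≤s z≤n
  𝟙-split true  false true  _ = s≤s z≤n
  𝟙-split true  false false h with () ← h _ _

  𝟙-cover : ∀ x y → 1 ≤ 𝟙 (not x ∧ not y) + 𝟙 x + 𝟙 y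
  𝟙-cover true  y     = s≤s z≤n
  𝟙-cover false true  = s≤s z≤n
  𝟙-cover false false = s≤s z≤n

  ==⇒≡ : ∀ {n} {u v : Fin n} → T (u == v) → u ≡ v
  ==⇒≡ {u = u} {v} _ with u ≟ v
  ... | yes u≡v = u≡v

  ≡⇒T== : ∀ {n} {u v : Fin n} → u ≡ v → T (u == v)
  ≡⇒T== {u = u} {v} u≡v with u ≟ v
  ... | yes _  = _
  ... | no u≢v = u≢v u≡v

  T-not==⇒≢ : ∀ {n} {u v : Fin n} → T (not (u == v)) → u ≢ v
  T-not==⇒≢ {u = u} {v} _ u≡v with u ≟ v
  ... | no u≢v = u≢v u≡v

  ≢⇒T-not== : ∀ {n} {u v : Fin n} → u ≢ v → T (not (u == v))
  ≢⇒T-not== {u = u} {v} u≢v with u ≟ v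
  ... | yes u≡v = u≢v u≡v
  ... | no _    = _

  ∑-mono-≤ : ∀ {n} {f g : Fin n → ℕ} → (∀ i → f i ≤ g i) → ∑[ i < n ] f i ≤ ∑[ i < n ] g i
  ∑-mono-≤ {zero}  f≤g = z≤n
  ∑-mono-≤ {suc n} f≤g = +-mono-≤ (f≤g zero) (∑-mono-≤ (λ i → f≤g (suc i)))

  ∑-const : ∀ n c → ∑[ i < n ] c ≡ n * c
  ∑-const zero    c = refl
  ∑-const (suc n) c = cong (c +_) (∑-const n c)

  ∑-𝟙-≤1 : ∀ {n} (p : Fin n → Bool) → (∀ i j → T (p i) → T (p j) → i ≡ j) →
           ∑[ i < n ] 𝟙 (p i) ≤ 1
  ∑-𝟙-≤1 {zero}  p unique = z≤n
  ∑-𝟙-≤1 {suc n} p unique with p zero in p₀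
  ... | false = ∑-𝟙-≤1 (p ∘ suc) λ i j pᵢ pⱼ → suc-injective (unique (suc i) (suc j) pᵢ pⱼ)
  ... | true  = ≤-reflexive (cong suc (trans (sum-cong-≗ none) (sum-replicate-zero n)))
    where
    none : ∀ i → 𝟙 (p (suc i)) ≡ 0
    none i with p (suc i) in pᵢ
    ... | false = refl
    ... | true with () ← unique zero (suc i) (subst T (sym p₀) _) (subst T (sym pᵢ) _)

  ∑-delta : ∀ {n} (v : Fin n) (h : Fin n → ℕ) → ∑[ u < n ] (𝟙 (v == u) * h u) ≡ h v
  ∑-delta {suc n} zero    h =
    trans (cong₂ _+_ (+-identityʳ (h zero)) (sum-replicate-zero n)) (+-identityʳ (h zero))
  ∑-delta {suc n} (suc v) h = ∑-delta v (h ∘ suc)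

  fibreSize : ∀ {m n} → (Fin m → Fin n) → Fin n → ℕ
  fibreSize {m} f v = ∑[ i < m ] 𝟙 (f i == v)

  ∑-fibres : ∀ {m n} (f : Fin m → Fin n) (g : Fin m → Fin n → ℕ) →
             ∑[ i < m ] g i (f i) ≡ ∑[ v < n ] ∑[ i < m ] (𝟙 (f i == v) * g i v)
  ∑-fibres {m} {n} f g = begin
    ∑[ i < m ] g i (f i)                         ≡⟨ sum-cong-≗ (λ i → ∑-delta (f i) (g i)) ⟨
    ∑[ i < m ] ∑[ v < n ] (𝟙 (f i == v) * g i v) ≡⟨ ∑-comm (λ i v → 𝟙 (f i == v) * g i v) ⟩
    ∑[ v < n ] ∑[ i < m ] (𝟙 (f i == v) * g i v) ∎
    where open ≡-Reasoning

  ∑-reindex-≤ : ∀ {m n} (f : Fin m → Fin n) (p : Fin m → Bool) (h : Fin n → ℕ) →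
                (∀ i j → T (p i) → T (p j) → f i ≡ f j → i ≡ j) →
                ∑[ i < m ] (𝟙 (p i) * h (f i)) ≤ ∑[ v < n ] h v
  ∑-reindex-≤ {m} {n} f p h injective = begin
    ∑[ i < m ] (𝟙 (p i) * h (f i))                          ≡⟨ ∑-fibres f (λ i v → 𝟙 (p i) * h v) ⟩
    ∑[ v < n ] ∑[ i < m ] (𝟙 (f i == v) * (𝟙 (p i) * h v)) ≡⟨ sum-cong-≗ fibre ⟩
    ∑[ v < n ] (∑[ i < m ] 𝟙 (f i == v ∧ p i) * h v)
      ≤⟨ ∑-mono-≤ (λ v → *-monoˡ-≤ (h v) (∑-𝟙-≤1 (λ i → f i == v ∧ p i) (unique v))) ⟩
    ∑[ v < n ] (1 * h v)                                     ≡⟨ sum-cong-≗ (λ v → *-identityˡ (h v)) ⟩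
    ∑[ v < n ] h v                                           ∎
    where
    open ≤-Reasoning
    fibre : ∀ v → ∑[ i < m ] (𝟙 (f i == v) * (𝟙 (p i) * h v)) ≡ ∑[ i < m ] 𝟙 (f i == v ∧ p i) * h v
    fibre v = trans (sum-cong-≗ λ i → trans (sym (*-assoc (𝟙 (f i == v)) (𝟙 (p i)) (h v)))
                                            (cong (_* h v) (sym (𝟙-∧ (f i == v) (p i)))))
                    (sym (*-distribʳ-sum (h v) (λ i → 𝟙 (f i == v ∧ p i))))
    unique : ∀ v i j → T (f i == v ∧ p i) → T (f j == v ∧ p j) → i ≡ j
    unique v i j hᵢ hⱼ with (fᵢ≡v , pᵢ) ← Equivalence.to T-∧ hᵢ | (fⱼ≡v , pⱼ) ← Equivalence.to T-∧ hⱼ =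
      injective i j pᵢ pⱼ (trans (==⇒≡ fᵢ≡v) (sym (==⇒≡ fⱼ≡v)))

  ∑-reindex₂-≤ : ∀ {m n} (f g : Fin m → Fin n) (h : Fin n → Fin n → ℕ) →
                 (∀ i j → f i ≡ f j → g i ≡ g j → i ≡ j) →
                 ∑[ i < m ] h (f i) (g i) ≤ ∑[ u < n ] ∑[ v < n ] h u v
  ∑-reindex₂-≤ {m} {n} f g h injective = begin
    ∑[ i < m ] h (f i) (g i)                         ≡⟨ ∑-fibres f (λ i u → h u (g i)) ⟩
    ∑[ u < n ] ∑[ i < m ] (𝟙 (f i == u) * h u (g i))
      ≤⟨ ∑-mono-≤ (λ u → ∑-reindex-≤ g (_== u ∘ f) (h u) (on-fibre u)) ⟩
    ∑[ u < n ] ∑[ v < n ] h u v                      ∎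
    where
    open ≤-Reasoning
    on-fibre : ∀ u i j → T (f i == u) → T (f j == u) → g i ≡ g j → i ≡ j
    on-fibre u i j fᵢ≡u fⱼ≡u = injective i j (trans (==⇒≡ fᵢ≡u) (sym (==⇒≡ fⱼ≡u)))

  light-fibres-≤ : ∀ {m n} K M (f : Fin m → Fin n) →
                   K * ∑[ i < m ] 𝟙 (K * fibreSize f (f i) <ᵇ M) ≤ n * M
  light-fibres-≤ {m} {n} K M f = begin
    K * ∑[ i < m ] 𝟙 (light (f i))                         ≡⟨ cong (K *_) (∑-fibres f (λ _ v → 𝟙 (light v))) ⟩
    K * ∑[ v < n ] ∑[ i < m ] (𝟙 (f i == v) * 𝟙 (light v))
      ≡⟨ cong (K *_) (sum-cong-≗ λ v → *-distribʳ-sum (𝟙 (light v)) (λ i → 𝟙 (f i == v))) ⟨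
    K * ∑[ v < n ] (fibreSize f v * 𝟙 (light v))           ≡⟨ *-distribˡ-sum K (λ v → fibreSize f v * 𝟙 (light v)) ⟩
    ∑[ v < n ] (K * (fibreSize f v * 𝟙 (light v)))         ≡⟨ sum-cong-≗ (λ v → *-assoc K (fibreSize f v) _) ⟨
    ∑[ v < n ] (K * fibreSize f v * 𝟙 (light v))           ≤⟨ ∑-mono-≤ (λ v → bounded (K * fibreSize f v)) ⟩
    ∑[ v < n ] M                                           ≡⟨ ∑-const n M ⟩
    n * M                                                  ∎
    where
    open ≤-Reasoning
    light : Fin n → Bool
    light v = K * fibreSize f v <ᵇ M
    bounded : ∀ x → x * 𝟙 (x <ᵇ M) ≤ M
    bounded x with x <ᵇ M in x<M
    ... | true  = ≤-trans (≤-reflexive (*-identityʳ x)) (<⇒≤ (<ᵇ⇒< x M (subst T (sym x<M) _)))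
    ... | false = ≤-trans (≤-reflexive (*-zeroʳ x)) z≤n

  module _ {A : Set} (p : A → Bool) where

    length-filter-tabulate : ∀ {n} (h : Fin n → A) →
                             length (filter (T? ∘ p) (tabulate h)) ≡ ∑[ i < n ] 𝟙 (p (h i))
    length-filter-tabulate {zero}  h = refl
    length-filter-tabulate {suc n} h with p (h zero)
    ... | true  = cong suc (length-filter-tabulate (h ∘ suc))
    ... | false = length-filter-tabulate (h ∘ suc)

    length-filter-concat-tabulate : ∀ {n} (f : Fin n → List A) →
      length (filter (T? ∘ p) (concat (tabulate f))) ≡ ∑[ i < n ] length (filter (T? ∘ p) (f i))
    length-filter-concat-tabulate {zero}  f = refl
    length-filter-concat-tabulate {suc n} f = begin
      length (filter (T? ∘ p) (f zero ++ concat (tabulate (f ∘ suc))))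
        ≡⟨ cong length (filter-++ (T? ∘ p) (f zero) _) ⟩
      length (filter (T? ∘ p) (f zero) ++ filter (T? ∘ p) (concat (tabulate (f ∘ suc))))
        ≡⟨ length-++ (filter (T? ∘ p) (f zero)) ⟩
      length (filter (T? ∘ p) (f zero)) + length (filter (T? ∘ p) (concat (tabulate (f ∘ suc))))
        ≡⟨ cong (length (filter (T? ∘ p) (f zero)) +_) (length-filter-concat-tabulate (f ∘ suc)) ⟩
      ∑[ i < suc n ] length (filter (T? ∘ p) (f i)) ∎
      where open ≡-Reasoning

    length-filter-map-allFin : ∀ {n} (h : Fin n → A) →
                               length (filter (T? ∘ p) (map h (allFin n))) ≡ ∑[ i < n ] 𝟙 (p (h i))
    length-filter-map-allFin h =
      trans (cong (length ∘ filter (T? ∘ p)) (map-tabulate id h)) (length-filter-tabulate h)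

    length-filter-concatMap-allFin : ∀ {n} {f : Fin n → List A} {s : Fin n → ℕ} →
      (∀ i → length (filter (T? ∘ p) (f i)) ≡ s i) →
      length (filter (T? ∘ p) (concatMap f (allFin n))) ≡ ∑[ i < n ] s i
    length-filter-concatMap-allFin {f = f} fᵢ≡sᵢ =
      trans (cong (length ∘ filter (T? ∘ p) ∘ concat) (map-tabulate id f))
            (trans (length-filter-concat-tabulate f) (sum-cong-≗ fᵢ≡sᵢ))

  length-filter-quadruples : ∀ {n} (p : Fin n × Fin n × Fin n × Fin n → Bool) →
    length (filter (T? ∘ p) (quadruples n)) ≡
    ∑[ x₁ < n ] ∑[ x₂ < n ] ∑[ x₃ < n ] ∑[ x₄ < n ] 𝟙 (p (x₁ , x₂ , x₃ , x₄))
  length-filter-quadruples p =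
    length-filter-concatMap-allFin p λ x₁ → length-filter-concatMap-allFin p λ x₂ →
    length-filter-concatMap-allFin p λ x₃ → length-filter-map-allFin p (λ x₄ → (x₁ , x₂ , x₃ , x₄))

module PopularFibres where

  open Counting
  open import Data.Bool using (Bool; T; _∧_; not)
  open import Data.Bool.Properties using (T-∧; T-not-≡)
  open import Data.Fin using (Fin)
  open import Data.Nat using (ℕ; zero; suc; _+_; _*_; _∸_; _≤_; s≤s; _<ᵇ_; NonZero)
  open import Data.Nat.Properties
    using (≤-trans; ≤-reflexive; ≮⇒≥; <⇒<ᵇ; +-identityʳ; +-mono-≤; +-monoʳ-≤; +-cancelʳ-≤; m≤n+m;
           *-assoc; *-identityʳ; *-mono-≤; *-monoˡ-≤; *-monoʳ-≤; *-cancelˡ-≤; m*n≢0;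
           module ≤-Reasoning; +-*-semiring)
  open import Algebra.Properties.Semiring.Sum +-*-semiring
    using (sum-syntax; ∑-distrib-+; *-distribˡ-sum; *-distribʳ-sum)
  open import Data.Nat.Solver using (module +-*-Solver)
  open import Data.Product using (_,_)
  open import Function using (Equivalence)
  open import Relation.Binary.PropositionalEquality

  ≮ᵇ⇒≥ : ∀ a b → T (not (a <ᵇ b)) → b ≤ a
  ≮ᵇ⇒≥ a b a≮b = ≮⇒≥ λ a<b → subst T (Equivalence.to T-not-≡ a≮b) (<⇒<ᵇ a<b)

  ≤2*[∸1] : ∀ {t} → 2 ≤ t → t ≤ 2 * (t ∸ 1)
  ≤2*[∸1] {suc zero}    (s≤s ())
  ≤2*[∸1] {suc (suc k)} _ = s≤s (≤-trans (≤-reflexive (sym (+-identityʳ (suc k)))) (m≤n+m (suc k + 0) k))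

  module _ {m n : ℕ} .{{_ : NonZero n}} where

    light : (Fin m → Fin n) → Fin m → Bool
    light f i = 4 * n * fibreSize f (f i) <ᵇ m

    bothHeavy : (Fin m → Fin n) → (Fin m → Fin n) → Fin m → Bool
    bothHeavy f g i = not (light f i) ∧ not (light g i)

    few-light : ∀ f → 4 * ∑[ i < m ] 𝟙 (light f i) ≤ m
    few-light f = *-cancelˡ-≤ n (begin
      n * (4 * L) ≡⟨ solve 2 (λ n L → n :* (con 4 :* L) := con 4 :* n :* L) refl n L ⟩
      4 * n * L   ≤⟨ light-fibres-≤ (4 * n) m f ⟩
      n * m       ∎)
      where
      open ≤-Reasoning
      open +-*-Solver
      L : ℕ
      L = ∑[ i < m ] 𝟙 (light f i)

    heavy-majority : ∀ f g → m ≤ 2 * ∑[ i < m ] 𝟙 (bothHeavy f g i)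
    heavy-majority f g = *-cancelˡ-≤ 2 (+-cancelʳ-≤ (2 * m) (2 * m) (2 * (2 * H)) (begin
      2 * m + 2 * m           ≡⟨ solve 1 (λ m → con 2 :* m :+ con 2 :* m := con 4 :* m) refl m ⟩
      4 * m                   ≤⟨ *-monoʳ-≤ 4 m≤H+Lf+Lg ⟩
      4 * (H + Lf + Lg)       ≡⟨ solve 3 (λ H a b → con 4 :* (H :+ a :+ b) := con 4 :* H :+ con 4 :* a :+ con 4 :* b)
                                       refl H Lf Lg ⟩
      4 * H + 4 * Lf + 4 * Lg ≤⟨ +-mono-≤ (+-monoʳ-≤ (4 * H) (few-light f)) (few-light g) ⟩
      4 * H + m + m           ≡⟨ solve 2 (λ H m → con 4 :* H :+ m :+ m := con 2 :* (con 2 :* H) :+ con 2 :* m)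
                                       refl H m ⟩
      2 * (2 * H) + 2 * m     ∎))
      where
      open ≤-Reasoning
      open +-*-Solver
      heavy : Fin m → ℕ
      heavy i = 𝟙 (bothHeavy f g i)
      H Lf Lg : ℕ
      H  = ∑[ i < m ] heavy i
      Lf = ∑[ i < m ] 𝟙 (light f i)
      Lg = ∑[ i < m ] 𝟙 (light g i)
      m≤H+Lf+Lg : m ≤ H + Lf + Lg
      m≤H+Lf+Lg = begin
        m                                                     ≡⟨ trans (∑-const m 1) (*-identityʳ m) ⟨
        ∑[ i < m ] 1                                          ≤⟨ ∑-mono-≤ (λ i → 𝟙-cover (light f i) (light g i)) ⟩
        ∑[ i < m ] (heavy i + 𝟙 (light f i) + 𝟙 (light g i))
          ≡⟨ ∑-distrib-+ (λ i → heavy i + 𝟙 (light f i)) (λ i → 𝟙 (light g i)) ⟩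
        ∑[ i < m ] (heavy i + 𝟙 (light f i)) + Lg
          ≡⟨ cong (_+ Lg) (∑-distrib-+ heavy (λ i → 𝟙 (light f i))) ⟩
        H + Lf + Lg                                           ∎

    heavy-product-≥ : ∀ f g i → 8 * n ≤ m → T (not (light f i)) → T (not (light g i)) →
                      m * m ≤ 32 * (n * n) * (fibreSize f (f i) * (fibreSize g (g i) ∸ 1))
    heavy-product-≥ f g i 8n≤m heavyᶠ heavyᵍ = begin
      m * m                               ≤⟨ *-mono-≤ m≤4nF (≤-trans m≤4nG (*-monoʳ-≤ (4 * n) (≤2*[∸1] 2≤G))) ⟩
      4 * n * F * (4 * n * (2 * (G ∸ 1))) ≡⟨ solve 3 (λ n F G → con 4 :* n :* F :* (con 4 :* n :* (con 2 :* G))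
                                                            := con 32 :* (n :* n) :* (F :* G)) refl n F (G ∸ 1) ⟩
      32 * (n * n) * (F * (G ∸ 1))        ∎
      where
      open ≤-Reasoning
      open +-*-Solver
      F G : ℕ
      F = fibreSize f (f i)
      G = fibreSize g (g i)
      m≤4nF : m ≤ 4 * n * F
      m≤4nF = ≮ᵇ⇒≥ (4 * n * F) m heavyᶠ
      m≤4nG : m ≤ 4 * n * G
      m≤4nG = ≮ᵇ⇒≥ (4 * n * G) m heavyᵍ
      2≤G : 2 ≤ G
      2≤G = *-cancelˡ-≤ (4 * n) {{m*n≢0 4 n}} (begin
        4 * n * 2 ≡⟨ solve 1 (λ n → con 4 :* n :* con 2 := con 8 :* n) refl n ⟩
        8 * n     ≤⟨ ≤-trans 8n≤m m≤4nG ⟩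
        4 * n * G ∎)

    cube-≤-∑-fibre-pairs : ∀ f g → 8 * n ≤ m →
      m * m * m ≤ 64 * (n * n) * ∑[ i < m ] (fibreSize f (f i) * (fibreSize g (g i) ∸ 1))
    cube-≤-∑-fibre-pairs f g 8n≤m = begin
      m * m * m                           ≡⟨ *-assoc m m m ⟩
      m * (m * m)                         ≤⟨ *-monoˡ-≤ (m * m) (heavy-majority f g) ⟩
      2 * H * (m * m)                     ≡⟨ *-assoc 2 H (m * m) ⟩
      2 * (H * (m * m))                   ≡⟨ cong (2 *_) (*-distribʳ-sum (m * m) heavy) ⟩
      2 * ∑[ i < m ] (heavy i * (m * m))  ≤⟨ *-monoʳ-≤ 2 (∑-mono-≤ heavy-bound) ⟩
      2 * ∑[ i < m ] (32 * (n * n) * P i) ≡⟨ cong (2 *_) (*-distribˡ-sum (32 * (n * n)) P) ⟨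
      2 * (32 * (n * n) * ∑[ i < m ] P i) ≡⟨ solve 2 (λ n S → con 2 :* (con 32 :* (n :* n) :* S)
                                                            := con 64 :* (n :* n) :* S) refl n (∑[ i < m ] P i) ⟩
      64 * (n * n) * ∑[ i < m ] P i       ∎
      where
      open ≤-Reasoning
      open +-*-Solver
      heavy P : Fin m → ℕ
      heavy i = 𝟙 (bothHeavy f g i)
      P i = fibreSize f (f i) * (fibreSize g (g i) ∸ 1)
      H : ℕ
      H = ∑[ i < m ] heavy i
      heavy-bound : ∀ i → heavy i * (m * m) ≤ 32 * (n * n) * P i
      heavy-bound i = 𝟙-*-≤ (bothHeavy f g i) λ h →
        let heavyᶠ , heavyᵍ = Equivalence.to T-∧ h in heavy-product-≥ f g i 8n≤m heavyᶠ heavyᵍ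

module TripartiteTriangles where

  open Counting
  open import Data.Bool using (T; _∧_)
  open import Data.Bool.Properties using (T-∧)
  open import Data.Empty using (⊥-elim)
  open import Data.Fin using (Fin)
  open import Data.Fin.Properties using (_≟_; all?)
  open import Data.Nat using (ℕ; _+_; _*_; _∸_; _≤_)
  open import Data.Nat.Properties
    using (+-monoˡ-≤; m≤n+o⇒m∸n≤o; module ≤-Reasoning; +-*-semiring)
  open import Algebra.Properties.Semiring.Sum +-*-semiring
    using (sum-syntax; ∑-comm; ∑-distrib-+; *-distribʳ-sum; sum-cong-≗)
  open import Data.Product using (_×_; _,_; ∃-syntax; proj₁; proj₂)
  open import Data.Sum using (_⊎_; inj₁; inj₂)
  open import Function using (Equivalence)
  open import Relation.Binary.PropositionalEquality
  open import Relation.Nullary using (¬_)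
  open import Relation.Nullary.Decidable using (yes; no; from-yes; ¬?; _→-dec_; _⊎-dec_)

  -- Kept abstract so that the 81-case enumeration is not re-run wherever it is unfolded.
  abstract
    fin3-cover : ∀ (u v w x : Fin 3) → u ≢ v → v ≢ w → u ≢ w → x ≡ u ⊎ x ≡ v ⊎ x ≡ w
    fin3-cover = from-yes (all? {n = 3} λ u → all? λ v → all? λ w → all? λ x →
      ¬? (u ≟ v) →-dec ¬? (v ≟ w) →-dec ¬? (u ≟ w) →-dec (x ≟ u ⊎-dec x ≟ v ⊎-dec x ≟ w))

  _&_ : ∀ {x y} → T x → T y → T (x ∧ y)
  p & q = Equivalence.from T-∧ (p , q)
  infixr 6 _&_

  module _ {n} (G : Graph n) where

    Adj-sym : ∀ {u v} → Adj G u v → Adj G v u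
    Adj-sym {u} {v} = subst T (Graph.sym G u v)

    ∈T-Adj : ∀ {τ u v} → IsTriangle G τ → u ∈T τ → v ∈T τ → u ≢ v → Adj G u v
    ∈T-Adj _            (inj₁ refl)        (inj₁ refl)        u≢v = ⊥-elim (u≢v refl)
    ∈T-Adj (xy , _ , _) (inj₁ refl)        (inj₂ (inj₁ refl)) _   = xy
    ∈T-Adj (_ , _ , xz) (inj₁ refl)        (inj₂ (inj₂ refl)) _   = xz
    ∈T-Adj (xy , _ , _) (inj₂ (inj₁ refl)) (inj₁ refl)        _   = Adj-sym xy
    ∈T-Adj _            (inj₂ (inj₁ refl)) (inj₂ (inj₁ refl)) u≢v = ⊥-elim (u≢v refl)
    ∈T-Adj (_ , yz , _) (inj₂ (inj₁ refl)) (inj₂ (inj₂ refl)) _   = yz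
    ∈T-Adj (_ , _ , xz) (inj₂ (inj₂ refl)) (inj₁ refl)        _   = Adj-sym xz
    ∈T-Adj (_ , yz , _) (inj₂ (inj₂ refl)) (inj₂ (inj₁ refl)) _   = Adj-sym yz
    ∈T-Adj _            (inj₂ (inj₂ refl)) (inj₂ (inj₂ refl)) u≢v = ⊥-elim (u≢v refl)

    triangle-meets-part : ∀ {part τ} → IsTripartition G part → IsTriangle G τ →
                          ∀ P → ∃[ v ] (v ∈T τ × part v ≡ P)
    triangle-meets-part {part} {x , y , z} tripartite (xy , yz , xz) P
      with fin3-cover (part x) (part y) (part z) P (tripartite x y xy) (tripartite y z yz) (tripartite x z xz)
    ... | inj₁ P≡x        = x , inj₁ refl , sym P≡x
    ... | inj₂ (inj₁ P≡y) = y , inj₂ (inj₁ refl) , sym P≡y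
    ... | inj₂ (inj₂ P≡z) = z , inj₂ (inj₂ refl) , sym P≡z

  module Packing {n} (G : Graph n) (part : Fin n → Fin 3) (tripartite : IsTripartition G part)
    {m} (t : Fin m → Fin n × Fin n × Fin n) (triangle : ∀ i → IsTriangle G (t i))
    (edge-disjoint : ∀ i j → i ≢ j → ¬ ShareEdge (t i) (t j)) where

    vertex : Fin 3 → Fin m → Fin n
    vertex P i = proj₁ (triangle-meets-part G tripartite (triangle i) P)

    vertex-∈T : ∀ P i → vertex P i ∈T t i
    vertex-∈T P i = proj₁ (proj₂ (triangle-meets-part G tripartite (triangle i) P))

    part-vertex : ∀ P i → part (vertex P i) ≡ P
    part-vertex P i = proj₂ (proj₂ (triangle-meets-part G tripartite (triangle i) P))

    vertex-≢ : ∀ {P Q} → P ≢ Q → ∀ i j → vertex P i ≢ vertex Q j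
    vertex-≢ P≢Q i j Pᵢ≡Qⱼ = P≢Q (trans (sym (part-vertex _ i)) (trans (cong part Pᵢ≡Qⱼ) (part-vertex _ j)))

    vertex-Adj : ∀ {P Q} → P ≢ Q → ∀ i → Adj G (vertex P i) (vertex Q i)
    vertex-Adj P≢Q i = ∈T-Adj G (triangle i) (vertex-∈T _ i) (vertex-∈T _ i) (vertex-≢ P≢Q i i)

    vertex-injective₂ : ∀ {P Q} → P ≢ Q → ∀ i j →
                        vertex P i ≡ vertex P j → vertex Q i ≡ vertex Q j → i ≡ j
    vertex-injective₂ {P} {Q} P≢Q i j Pᵢ≡Pⱼ Qᵢ≡Qⱼ with i ≟ j
    ... | yes i≡j = i≡j
    ... | no i≢j  = ⊥-elim (edge-disjoint i j i≢j
            (vertex P i , vertex Q i , vertex-≢ P≢Q i i , vertex-∈T P i , vertex-∈T Q i ,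
             subst (_∈T t j) (sym Pᵢ≡Pⱼ) (vertex-∈T P j) , subst (_∈T t j) (sym Qᵢ≡Qⱼ) (vertex-∈T Q j)))

    a b c : Fin m → Fin n
    a = vertex partA
    b = vertex partB
    c = vertex partC

    a-injective-on-fibre : ∀ {Q} → partA ≢ Q → ∀ v i j →
                           T (vertex Q i == v) → T (vertex Q j == v) → a i ≡ a j → i ≡ j
    a-injective-on-fibre A≢Q v i j Qᵢ≡v Qⱼ≡v aᵢ≡aⱼ =
      vertex-injective₂ A≢Q i j aᵢ≡aⱼ (trans (==⇒≡ Qᵢ≡v) (sym (==⇒≡ Qⱼ≡v)))

    abca-path : ∀ {i j k} → b j ≡ b i → c k ≡ c i → a j ≢ a k →
                T (isABCAPath G part (a j , b i , c i , a k))
    abca-path {i} {j} {k} bⱼ≡bᵢ cₖ≡cᵢ aⱼ≢aₖ =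
      ≡⇒T== (part-vertex partA j) & ≡⇒T== (part-vertex partB i) &
      ≡⇒T== (part-vertex partC i) & ≡⇒T== (part-vertex partA k) &
      subst (Adj G (a j)) bⱼ≡bᵢ (vertex-Adj (λ ()) j) & vertex-Adj (λ ()) i &
      subst (λ v → Adj G v (a k)) cₖ≡cᵢ (vertex-Adj (λ ()) k) &
      ≢⇒T-not== (vertex-≢ (λ ()) j i) & ≢⇒T-not== (vertex-≢ (λ ()) j i) & ≢⇒T-not== aⱼ≢aₖ &
      ≢⇒T-not== (vertex-≢ (λ ()) i i) & ≢⇒T-not== (vertex-≢ (λ ()) i k) & ≢⇒T-not== (vertex-≢ (λ ()) i k)

    private
      path : Fin n → Fin n → Fin n → Fin n → ℕ
      path x₁ x₂ x₃ x₄ = 𝟙 (isABCAPath G part (x₁ , x₂ , x₃ , x₄))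

    closing-triangles-≥ : ∀ {i j} → b j ≡ b i →
      fibreSize c (c i) ∸ 1 ≤ ∑[ k < m ] (𝟙 (c k == c i) * path (a j) (b i) (c i) (a k))
    closing-triangles-≥ {i} {j} bⱼ≡bᵢ = m≤n+o⇒m∸n≤o (fibreSize c (c i)) 1 (begin
      ∑[ k < m ] 𝟙 (c k == c i)                                 ≤⟨ ∑-mono-≤ split ⟩
      ∑[ k < m ] (𝟙 (c k == c i ∧ a k == a j) + closes k)
        ≡⟨ ∑-distrib-+ (λ k → 𝟙 (c k == c i ∧ a k == a j)) closes ⟩
      ∑[ k < m ] 𝟙 (c k == c i ∧ a k == a j) + ∑[ k < m ] closes k
        ≤⟨ +-monoˡ-≤ (∑[ k < m ] closes k) (∑-𝟙-≤1 _ unique) ⟩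
      1 + ∑[ k < m ] closes k                                   ∎)
      where
      open ≤-Reasoning
      closes : Fin m → ℕ
      closes k = 𝟙 (c k == c i) * path (a j) (b i) (c i) (a k)
      split : ∀ k → 𝟙 (c k == c i) ≤ 𝟙 (c k == c i ∧ a k == a j) + closes k
      split k = 𝟙-split (c k == c i) (a k == a j) _ λ cₖ≡cᵢ aₖ≢aⱼ →
        abca-path bⱼ≡bᵢ (==⇒≡ cₖ≡cᵢ) (λ aⱼ≡aₖ → T-not==⇒≢ aₖ≢aⱼ (sym aⱼ≡aₖ))
      unique : ∀ k k′ → T (c k == c i ∧ a k == a j) → T (c k′ == c i ∧ a k′ == a j) → k ≡ k′
      unique k k′ hₖ hₖ′ with (cₖ , aₖ) ← Equivalence.to T-∧ hₖ | (cₖ′ , aₖ′) ← Equivalence.to T-∧ hₖ′ =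
        vertex-injective₂ {partA} {partC} (λ ()) k k′
          (trans (==⇒≡ aₖ) (sym (==⇒≡ aₖ′))) (trans (==⇒≡ cₖ) (sym (==⇒≡ cₖ′)))

    paths-through-≥ : ∀ i → fibreSize b (b i) * (fibreSize c (c i) ∸ 1) ≤
                            ∑[ x₁ < n ] ∑[ x₄ < n ] path x₁ (b i) (c i) x₄
    paths-through-≥ i = begin
      fibreSize b (b i) * (fibreSize c (c i) ∸ 1)
        ≡⟨ *-distribʳ-sum (fibreSize c (c i) ∸ 1) (λ j → 𝟙 (b j == b i)) ⟩
      ∑[ j < m ] (𝟙 (b j == b i) * (fibreSize c (c i) ∸ 1))
        ≤⟨ ∑-mono-≤ (λ j → 𝟙-*-mono-≤ (b j == b i) λ bⱼ≡bᵢ → begin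
             fibreSize c (c i) ∸ 1                                       ≤⟨ closing-triangles-≥ (==⇒≡ bⱼ≡bᵢ) ⟩
             ∑[ k < m ] (𝟙 (c k == c i) * path (a j) (b i) (c i) (a k))
               ≤⟨ ∑-reindex-≤ a (λ k → c k == c i) (path (a j) (b i) (c i))
                              (a-injective-on-fibre (λ ()) (c i)) ⟩
             ∑[ x₄ < n ] path (a j) (b i) (c i) x₄                        ∎) ⟩
      ∑[ j < m ] (𝟙 (b j == b i) * ∑[ x₄ < n ] path (a j) (b i) (c i) x₄)
        ≤⟨ ∑-reindex-≤ a (λ j → b j == b i) (λ x₁ → ∑[ x₄ < n ] path x₁ (b i) (c i) x₄)
                       (a-injective-on-fibre (λ ()) (b i)) ⟩
      ∑[ x₁ < n ] ∑[ x₄ < n ] path x₁ (b i) (c i) x₄ ∎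
      where open ≤-Reasoning

    ∑-fibre-pairs-≤-paths :
      ∑[ i < m ] (fibreSize b (b i) * (fibreSize c (c i) ∸ 1)) ≤ numABCAPaths G part
    ∑-fibre-pairs-≤-paths = begin
      ∑[ i < m ] (fibreSize b (b i) * (fibreSize c (c i) ∸ 1)) ≤⟨ ∑-mono-≤ paths-through-≥ ⟩
      ∑[ i < m ] through (b i) (c i)
        ≤⟨ ∑-reindex₂-≤ b c through (vertex-injective₂ (λ ())) ⟩
      ∑[ x₂ < n ] ∑[ x₃ < n ] through x₂ x₃                   ≡⟨ reorder ⟩
      ∑[ x₁ < n ] ∑[ x₂ < n ] ∑[ x₃ < n ] ∑[ x₄ < n ] path x₁ x₂ x₃ x₄
        ≡⟨ length-filter-quadruples (isABCAPath G part) ⟨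
      numABCAPaths G part                                     ∎
      where
      open ≤-Reasoning
      through : Fin n → Fin n → ℕ
      through x₂ x₃ = ∑[ x₁ < n ] ∑[ x₄ < n ] path x₁ x₂ x₃ x₄
      reorder : ∑[ x₂ < n ] ∑[ x₃ < n ] through x₂ x₃ ≡
                ∑[ x₁ < n ] ∑[ x₂ < n ] ∑[ x₃ < n ] ∑[ x₄ < n ] path x₁ x₂ x₃ x₄
      reorder = sym (trans (∑-comm (λ x₁ x₂ → ∑[ x₃ < n ] ∑[ x₄ < n ] path x₁ x₂ x₃ x₄))
                           (sum-cong-≗ λ x₂ → ∑-comm (λ x₁ x₃ → ∑[ x₄ < n ] path x₁ x₂ x₃ x₄)))

open import Data.Nat using (ℕ; NonZero) renaming (_*_ to _*ℕ_)
open import Data.Fin using (Fin)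
open import Data.Integer using (+_)
open import Data.Rational using (ℚ; _/_; _*_; _≤_; _<_; 0ℚ)
open import Data.Product using (_×_; ∃-syntax)

open import Data.Nat using (zero; suc; ≢-nonZero⁻¹) renaming (_≤_ to _≤ℕ_)
import Data.Nat.Properties as ℕ
open import Data.Integer using (+≤+)
import Data.Integer as ℤ
import Data.Integer.Properties as ℤ
open import Data.Rational using (1ℚ; toℚᵘ; NonNegative; Positive; nonNegative)
open import Data.Rational.Properties
  using (toℚᵘ-fromℚᵘ; toℚᵘ-injective; toℚᵘ-homo-*; toℚᵘ-mono-≤; toℚᵘ-cancel-≤; ≤-trans;
         *-monoˡ-≤-nonNeg; *-monoʳ-≤-nonNeg; *-cancelʳ-≤-pos; *-identityˡ; nonNeg*nonNeg⇒nonNeg;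
         nonNegative⁻¹; positive⁻¹; normalize-nonNeg; normalize-pos; module ≤-Reasoning)
open import Data.Rational.Unnormalised using (mkℚᵘ; *≤*) renaming (_≃_ to _≃ᵘ_)
import Data.Rational.Unnormalised as ℚᵘ
import Data.Rational.Unnormalised.Properties as ℚᵘ
import Data.Rational.Solver as ℚ-Solver
open import Data.Product using (_,_)
open import Relation.Binary.PropositionalEquality
open import Relation.Nullary using (contradiction)
open PopularFibres using (cube-≤-∑-fibre-pairs)
open TripartiteTriangles using (module Packing)

fromℕ : ℕ → ℚ
fromℕ a = + a / 1

toℚᵘ-/ : ∀ i k → toℚᵘ (i / suc k) ≃ᵘ mkℚᵘ i k
toℚᵘ-/ i k = toℚᵘ-fromℚᵘ (mkℚᵘ i k)

fromℕ-* : ∀ a b → fromℕ (a *ℕ b) ≡ fromℕ a * fromℕ b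
fromℕ-* a b = toℚᵘ-injective (begin
  toℚᵘ (fromℕ (a *ℕ b))                ≈⟨ toℚᵘ-/ (+ (a *ℕ b)) 0 ⟩
  mkℚᵘ (+ (a *ℕ b)) 0                  ≡⟨ cong (λ i → mkℚᵘ i 0) (ℤ.pos-* a b) ⟩
  mkℚᵘ (+ a) 0 ℚᵘ.* mkℚᵘ (+ b) 0      ≈⟨ ℚᵘ.*-cong (toℚᵘ-/ (+ a) 0) (toℚᵘ-/ (+ b) 0) ⟨
  toℚᵘ (fromℕ a) ℚᵘ.* toℚᵘ (fromℕ b)  ≈⟨ toℚᵘ-homo-* (fromℕ a) (fromℕ b) ⟨
  toℚᵘ (fromℕ a * fromℕ b)            ∎)
  where open ℚᵘ.≃-Reasoning

fromℕ-mono-≤ : ∀ {a b} → a ≤ℕ b → fromℕ a ≤ fromℕ b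
fromℕ-mono-≤ {a} {b} a≤b = toℚᵘ-cancel-≤
  (ℚᵘ.≤-respˡ-≃ (ℚᵘ.≃-sym (toℚᵘ-/ (+ a) 0)) (ℚᵘ.≤-respʳ-≃ (ℚᵘ.≃-sym (toℚᵘ-/ (+ b) 0))
    (*≤* (ℤ.*-monoʳ-≤-nonNeg (+ 1) (+≤+ a≤b)))))

/-*-square-≤⇒ : ∀ a n .{{_ : NonZero n}} m → (+ a / n) * fromℕ (n *ℕ n) ≤ fromℕ m → a *ℕ n ≤ℕ m
/-*-square-≤⇒ a zero        m _ = contradiction refl (≢-nonZero⁻¹ zero)
/-*-square-≤⇒ a n@(suc k) m h = ℕ.*-cancelʳ-≤ (a *ℕ n) m n (ℤ.drop‿+≤+ (subst₂ ℤ._≤_ lhs rhs (ℚᵘ.drop-*≤* hᵘ)))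
  where
  hᵘ : mkℚᵘ (+ a) k ℚᵘ.* mkℚᵘ (+ (n *ℕ n)) 0 ℚᵘ.≤ mkℚᵘ (+ m) 0
  hᵘ = ℚᵘ.≤-respʳ-≃ (toℚᵘ-/ (+ m) 0) (ℚᵘ.≤-respˡ-≃ (ℚᵘ.≃-trans (toℚᵘ-homo-* (+ a / n) (fromℕ (n *ℕ n)))
         (ℚᵘ.*-cong (toℚᵘ-/ (+ a) k) (toℚᵘ-/ (+ (n *ℕ n)) 0))) (toℚᵘ-mono-≤ h))
  lhs : + a ℤ.* + (n *ℕ n) ℤ.* + 1 ≡ + (a *ℕ n *ℕ n)
  lhs = trans (ℤ.*-identityʳ _) (trans (sym (ℤ.pos-* a (n *ℕ n))) (cong +_ (sym (ℕ.*-assoc a n n))))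
  rhs : + m ℤ.* + (n *ℕ 1) ≡ + (m *ℕ n)
  rhs = trans (sym (ℤ.pos-* m (n *ℕ 1))) (cong (λ d → + (m *ℕ d)) (ℕ.*-identityʳ n))

cube-mono-≤ : ∀ {x y} → 0ℚ ≤ x → x ≤ y → x * x * x ≤ y * y * y
cube-mono-≤ {x} {y} 0≤x x≤y = begin
  x * x * x ≤⟨ *-monoˡ-≤-nonNeg (x * x) x≤y ⟩
  x * x * y ≤⟨ *-monoʳ-≤-nonNeg y (*-monoˡ-≤-nonNeg x x≤y) ⟩
  x * y * y ≤⟨ *-monoʳ-≤-nonNeg y (*-monoʳ-≤-nonNeg y x≤y) ⟩
  y * y * y ∎
  where
  open ≤-Reasoning
  instance
    _ : NonNegative x
    _ = nonNegative 0≤x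
    _ : NonNegative y
    _ = nonNegative (≤-trans 0≤x x≤y)
    _ : NonNegative (x * x)
    _ = nonNeg*nonNeg⇒nonNeg x x
    _ : NonNegative (y * y)
    _ = nonNeg*nonNeg⇒nonNeg y y

cube-bound : ∀ n .{{_ : NonZero n}} (p : ℚ) m P → 0ℚ ≤ p → p * fromℕ (n *ℕ n) ≤ fromℕ m →
             m *ℕ m *ℕ m ≤ℕ 64 *ℕ (n *ℕ n) *ℕ P →
             + 1 / 64 * p * p * p * fromℕ (n *ℕ n *ℕ n *ℕ n) ≤ fromℕ P
cube-bound n p m P 0≤p pN²≤m m³≤64n²P = *-cancelʳ-≤-pos K (begin
  + 1 / 64 * p * p * p * fromℕ (n *ℕ n *ℕ n *ℕ n) * K
    ≡⟨ cong₂ (λ N⁴ K → + 1 / 64 * p * p * p * N⁴ * K) N⁴≡N²N² K≡64N² ⟩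
  + 1 / 64 * p * p * p * (N² * N²) * (fromℕ 64 * N²)
    ≡⟨ solve 4 (λ c p N s → c :* p :* p :* p :* (N :* N) :* (s :* N)
                         := (c :* s) :* ((p :* N) :* (p :* N) :* (p :* N))) refl (+ 1 / 64) p N² (fromℕ 64) ⟩
  1ℚ * ((p * N²) * (p * N²) * (p * N²))
    ≡⟨ *-identityˡ _ ⟩
  (p * N²) * (p * N²) * (p * N²)
    ≤⟨ cube-mono-≤ (nonNegative⁻¹ (p * N²) {{nonNeg*nonNeg⇒nonNeg p {{nonNegative 0≤p}} N²}}) pN²≤m ⟩
  fromℕ m * fromℕ m * fromℕ m
    ≡⟨ trans (fromℕ-* (m *ℕ m) m) (cong (_* fromℕ m) (fromℕ-* m m)) ⟨
  fromℕ (m *ℕ m *ℕ m)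
    ≤⟨ fromℕ-mono-≤ (ℕ.≤-trans m³≤64n²P (ℕ.≤-reflexive (ℕ.*-comm (64 *ℕ (n *ℕ n)) P))) ⟩
  fromℕ (P *ℕ (64 *ℕ (n *ℕ n)))
    ≡⟨ fromℕ-* P (64 *ℕ (n *ℕ n)) ⟩
  fromℕ P * K ∎)
  where
  open ≤-Reasoning
  open ℚ-Solver.+-*-Solver
  N² K : ℚ
  N² = fromℕ (n *ℕ n)
  K = fromℕ (64 *ℕ (n *ℕ n))
  instance
    _ : NonNegative N²
    _ = normalize-nonNeg (n *ℕ n) 1
    _ : Positive K
    _ = normalize-pos (64 *ℕ (n *ℕ n)) 1 {{_}} {{ℕ.m*n≢0 64 (n *ℕ n) {{_}} {{ℕ.m*n≢0 n n}}}}
  N⁴≡N²N² : fromℕ (n *ℕ n *ℕ n *ℕ n) ≡ N² * N²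
  N⁴≡N²N² = trans (cong fromℕ (ℕ.*-assoc (n *ℕ n) n n)) (fromℕ-* (n *ℕ n) (n *ℕ n))
  K≡64N² : K ≡ fromℕ 64 * N²
  K≡64N² = fromℕ-* 64 (n *ℕ n)

abca-paths-≥ : ∀ (n : ℕ) .{{_ : NonZero n}} (p : ℚ) → (+ 100 / n) ≤ p →
               (G : Graph n) (part : Fin n → Fin 3) → IsTripartition G part →
               (m : ℕ) → p * (+ (n *ℕ n) / 1) ≤ (+ m / 1) → HasEdgeDisjointTriangles G m →
               + 1 / 64 * p * p * p * (+ (n *ℕ n *ℕ n *ℕ n) / 1) ≤ (+ numABCAPaths G part / 1)
abca-paths-≥ n p 100/n≤p G part tripartite m pn²≤m (t , triangle , edge-disjoint) =
  cube-bound n p m (numABCAPaths G part) 0≤p pn²≤m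
    (ℕ.≤-trans (cube-≤-∑-fibre-pairs b c 8n≤m) (ℕ.*-monoʳ-≤ (64 *ℕ (n *ℕ n)) ∑-fibre-pairs-≤-paths))
  where
  open Packing G part tripartite t triangle edge-disjoint using (b; c; ∑-fibre-pairs-≤-paths)
  0≤p : 0ℚ ≤ p
  0≤p = ≤-trans (nonNegative⁻¹ (+ 100 / n) {{normalize-nonNeg 100 n}}) 100/n≤p
  100n≤m : 100 *ℕ n ≤ℕ m
  100n≤m = /-*-square-≤⇒ 100 n m
    (≤-trans (*-monoʳ-≤-nonNeg (fromℕ (n *ℕ n)) {{normalize-nonNeg (n *ℕ n) 1}} 100/n≤p) pn²≤m)
  8n≤m : 8 *ℕ n ≤ℕ m
  8n≤m = ℕ.≤-trans (ℕ.*-monoˡ-≤ n (ℕ.m≤m+n 8 92)) 100n≤m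

proposition2p18 : ∃[ c ] (0ℚ < c ×
    (∀ (n : ℕ) .{{_ : NonZero n}} (p : ℚ) → (+ 100 / n) ≤ p →
    (G : Graph n) (part : Fin n → Fin 3) → IsTripartition G part →
    (m : ℕ) → p * (+ (n *ℕ n) / 1) ≤ (+ m / 1) → HasEdgeDisjointTriangles G m →
    c * p * p * p * (+ (n *ℕ n *ℕ n *ℕ n) / 1) ≤ (+ numABCAPaths G part / 1)))
proposition2p18 = + 1 / 64 , positive⁻¹ (+ 1 / 64) {{normalize-pos 1 64}} , abca-paths-≥
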